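{- Let $\Omega$ be a set of orderings, and let $(x,Y)$ be a ladder in $\Omega$ with $Y=(y_0,\dots,y_{k-1})$. For $-1\le i\le k-1$ let $W_i$ be the set of orderings of $\Omega$ whose rung is $i$. Then for every integer $i$ with $0\le i<k$, $|W_i|\le |W_{i-1}|$.
   Context: A set of orderings $\Omega$ on a finite set $S$ is a nonempty set of total orderings of $S$. For an element $x$ and a nonempty sequence $Y=(y_0,\dots,y_{k-1})$ of distinct elements, $(x,Y)$ is a ladder in $\Omega$ if: (1) in every ordering of $\Omega$, the elements of $Y$ occurring earlier than $x$ occur in the order given by $Y$; (2) whenever $w\in\Omega$ has some elements of $Y$ earlier than $x$ and $i$ is the largest index with $y_i$ earlier than $x$ in $w$, the ordering obtained by swapping $x$ and $y_i$ in $w$ belongs to $\Omega$. The rung of an ordering $w$ is the largest index $i$ such that $y_i$ occurs earlier than $x$ in $w$, or $-1$ if no element of $Y$ occurs earlier than $x$. -}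

module Defs where

open import Data.Nat using (ℕ; zero; suc; _<_; _≤_; _<?_)
open import Data.Integer using (ℤ; +_; -1ℤ; _⊔_)
open import Data.Fin using (Fin; toℕ; _≟_)
open import Data.Vec using (Vec; lookup; toList; map; allFin)
open import Data.List using (List; []; _∷_; length; filter)
open import Data.List.Relation.Unary.Unique.Propositional using (Unique)
open import Data.List.Membership.Propositional using (_∈_)
open import Data.Product using (Σ; _×_; ∃)
open import Relation.Nullary using (Dec; ¬_; yes; no)
open import Relation.Nullary.Decidable using (does)
open import Data.Bool using (if_then_else_)
open import Function.Bundles using (_⇔_)

-- An ordering of the finite set S = Fin n is represented by its rank vector:
-- pos = lookup w a is the position of element a. It is a total ordering iff
-- the ranks are pairwise distinct (then a ↦ rank is a bijection Fin n → Fin n).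
Ordering : ℕ → Set
Ordering n = Vec (Fin n) n

IsOrdering : ∀ {n} → Ordering n → Set
IsOrdering w = Unique (toList w)

Earlier : ∀ {n} → Ordering n → Fin n → Fin n → Set
Earlier w a b = toℕ (lookup w a) < toℕ (lookup w b)

earlier? : ∀ {n} (w : Ordering n) (a b : Fin n) → Dec (Earlier w a b)
earlier? w a b = toℕ (lookup w a) <? toℕ (lookup w b)

swap : ∀ {n} → Fin n → Fin n → Ordering n → Ordering n
swap a b w = map (λ c → if does (c ≟ a) then lookup w b
                        else if does (c ≟ b) then lookup w a else lookup w c) (allFin _)

record OrderingSet (n : ℕ) : Set where
  field
    elems    : List (Ordering n)
    distinct : Unique elems
    valid    : ∀ {w} → w ∈ elems → IsOrdering w
    nonempty : Σ (Ordering n) (λ w → w ∈ elems)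
open OrderingSet public

record IsLadder {n k : ℕ} (Ω : OrderingSet n) (x : Fin n) (Y : Vec (Fin n) (suc k)) : Set where
  field
    Y-distinct : Unique (toList Y)
    cond1 : ∀ {w} → w ∈ elems Ω →
      Σ ℕ λ m → m ≤ suc k ×
        ((∀ (j : Fin (suc k)) → Earlier w (lookup Y j) x ⇔ (toℕ j < m)) ×
         (∀ (j j' : Fin (suc k)) → toℕ j < toℕ j' → toℕ j' < m →
            Earlier w (lookup Y j) (lookup Y j')))
    cond2 : ∀ {w} → w ∈ elems Ω → ∀ (i : Fin (suc k)) →
      Earlier w (lookup Y i) x →
      (∀ (j : Fin (suc k)) → toℕ i < toℕ j → ¬ Earlier w (lookup Y j) x) →
      swap x (lookup Y i) w ∈ elems Ω

rungFrom : ∀ {n} → Ordering n → Fin n → ℕ → List (Fin n) → ℤ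
rungFrom w x j [] = -1ℤ
rungFrom w x j (y ∷ ys) =
  (if does (earlier? w y x) then + j else -1ℤ) ⊔ rungFrom w x (suc j) ys

rung : ∀ {n k} → Ordering n → Fin n → Vec (Fin n) k → ℤ
rung w x Y = rungFrom w x 0 (toList Y)

W : ∀ {n k} → OrderingSet n → Fin n → Vec (Fin n) k → ℤ → List (Ordering n)
W Ω x Y i = filter (λ w → rung w x Y Data.Integer.≟ i) (elems Ω)

module Submission where

-- If (x , Y) is a ladder in Ω, then swapping x with y_i is an injection
-- from W_i (orderings of rung i) into W_{i-1}; since Ω is duplicate-free,
-- |W_i| ≤ |W_{i-1}| follows.
--
-- Ladder condition (1) forces every ordering of rung i to have that shape
-- with m = i + 1; condition (2) keeps the swapped ordering in Ω.

open import Defs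
open import Data.Nat using (ℕ; zero; suc; _<_; _≤_; z≤n; s≤s; s≤s⁻¹; _+_)
open import Data.Nat.Properties
  using (<-irrefl; <-asym; <-trans; <⇒≤; <⇒≱; n<1+n; m≤m+n; +-suc; +-identityʳ)
open import Data.Integer using (ℤ; +_; _-_; -1ℤ; _⊔_; +≤+; -≤+)
import Data.Integer as ℤ
open import Data.Integer.Properties using (+-injective; i≤j⇒i⊔j≡j)
import Data.Fin as Fin
open import Data.Fin using (Fin; toℕ; _≟_; fromℕ<) renaming (zero to fzero; suc to fsuc)
open import Data.Fin.Properties using (toℕ-fromℕ<; toℕ<n; <-cmp)
open import Data.Vec using (Vec; []; _∷_; lookup; toList; allFin)
open import Data.Vec.Properties using (lookup-map; lookup-allFin; tabulate∘lookup; tabulate-cong)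
open import Data.List using (List; []; _∷_; length; _++_)
import Data.List as List
open import Data.List.Properties using (length-map; length-++-sucʳ)
import Data.List.Relation.Unary.All as All
open import Data.List.Relation.Unary.AllPairs using (_∷_)
open import Data.List.Relation.Unary.Any using (here; there)
open import Data.List.Relation.Unary.Unique.Propositional using (Unique)
import Data.List.Relation.Unary.Unique.Propositional.Properties as Unique
open import Data.List.Membership.Propositional using (_∈_)
open import Data.List.Membership.Propositional.Properties
  using (∈-∃++; ∈-++⁻; ∈-++⁺ˡ; ∈-++⁺ʳ; ∈-filter⁺; ∈-filter⁻; ∈-map⁻)
open import Data.Product using (_×_; _,_; proj₁)
open import Data.Sum using (inj₁; inj₂)
open import Data.Empty using (⊥-elim)
open import Data.Bool using (Bool; true; false; if_then_else_)
open import Relation.Nullary using (¬_; yes; no)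
open import Relation.Nullary.Decidable using (does; dec-true; dec-false)
open import Relation.Binary.Definitions using (Tri; tri<; tri≈; tri>)
open import Function.Bundles using (_⇔_; mk⇔; Equivalence)
open import Relation.Binary.PropositionalEquality
  using (_≡_; _≢_; refl; sym; trans; cong; subst; subst₂; module ≡-Reasoning)

open Equivalence using (to; from)

-- A duplicate-free list contained in ys is at most as long as ys:
-- remove each element of xs from ys in turn.
unique-⊆-length : ∀ {A : Set} {xs ys : List A} → Unique xs →
  (∀ {z} → z ∈ xs → z ∈ ys) → length xs ≤ length ys
unique-⊆-length {xs = []} _ _ = z≤n
unique-⊆-length {xs = a ∷ xs} {ys} (a∉xs ∷ uxs) xs⊆ys with ∈-∃++ (xs⊆ys (here refl))
... | ys₁ , ys₂ , refl =
  subst (suc (length xs) ≤_) (sym (length-++-sucʳ ys₁ a ys₂))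
        (s≤s (unique-⊆-length uxs xs⊆ys₁++ys₂))
  where
  xs⊆ys₁++ys₂ : ∀ {z} → z ∈ xs → z ∈ ys₁ ++ ys₂
  xs⊆ys₁++ys₂ {z} z∈xs with ∈-++⁻ ys₁ (xs⊆ys (there z∈xs))
  ... | inj₁ z∈ys₁         = ∈-++⁺ˡ z∈ys₁
  ... | inj₂ (here z≡a)    = ⊥-elim (All.lookup a∉xs z∈xs (sym z≡a))
  ... | inj₂ (there z∈ys₂) = ∈-++⁺ʳ ys₁ z∈ys₂

injection-length-≤ : ∀ {A B : Set} {xs : List A} {ys : List B} (f : A → B) →
  Unique xs → (∀ {a b} → f a ≡ f b → a ≡ b) →
  (∀ {z} → z ∈ xs → f z ∈ ys) → length xs ≤ length ys
injection-length-≤ {xs = xs} {ys} f uxs f-inj maps-into =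
  subst (_≤ length ys) (length-map f xs)
        (unique-⊆-length (Unique.map⁺ f-inj uxs) image⊆ys)
  where
  image⊆ys : ∀ {z} → z ∈ List.map f xs → z ∈ ys
  image⊆ys z∈image with ∈-map⁻ f z∈image
  ... | a , a∈xs , refl = maps-into a∈xs

module _ {n : ℕ} where

  lookup-swap : ∀ a b (w : Ordering n) c → lookup (swap a b w) c ≡
    (if does (c ≟ a) then lookup w b else if does (c ≟ b) then lookup w a else lookup w c)
  lookup-swap a b w c =
    trans (lookup-map c _ (allFin _))
          (cong (λ c′ → if does (c′ ≟ a) then lookup w b
                        else if does (c′ ≟ b) then lookup w a else lookup w c′)
                (lookup-allFin c))

  swap-at-a : ∀ a b (w : Ordering n) → lookup (swap a b w) a ≡ lookup w b
  swap-at-a a b w rewrite lookup-swap a b w a | dec-true (a ≟ a) refl = refl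

  swap-at-b : ∀ a b (w : Ordering n) → lookup (swap a b w) b ≡ lookup w a
  swap-at-b a b w rewrite lookup-swap a b w b with b ≟ a
  ... | yes refl = refl
  ... | no _ rewrite dec-true (b ≟ b) refl = refl

  swap-elsewhere : ∀ a b (w : Ordering n) c → c ≢ a → c ≢ b →
    lookup (swap a b w) c ≡ lookup w c
  swap-elsewhere a b w c c≢a c≢b
    rewrite lookup-swap a b w c | dec-false (c ≟ a) c≢a | dec-false (c ≟ b) c≢b = refl

  swap-involutive : ∀ a b (w : Ordering n) → swap a b (swap a b w) ≡ w
  swap-involutive a b w =
    trans (sym (tabulate∘lookup (swap a b (swap a b w)))) (trans (tabulate-cong pointwise) (tabulate∘lookup w))
    where
    pointwise : ∀ c → lookup (swap a b (swap a b w)) c ≡ lookup w c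
    pointwise c with c ≟ a
    ... | yes refl = trans (swap-at-a c b (swap c b w)) (swap-at-b c b w)
    ... | no c≢a with c ≟ b
    ... | yes refl = trans (swap-at-b a c (swap a c w)) (swap-at-a a c w)
    ... | no c≢b = trans (swap-elsewhere a b (swap a b w) c c≢a c≢b) (swap-elsewhere a b w c c≢a c≢b)

  swap-injective : ∀ a b {w w′ : Ordering n} → swap a b w ≡ swap a b w′ → w ≡ w′
  swap-injective a b {w} {w′} eq =
    trans (sym (swap-involutive a b w)) (trans (cong (swap a b) eq) (swap-involutive a b w′))

  module _ (w : Ordering n) (a b : Fin n) (b<a : Earlier w b a) where

    swap-reverses : ¬ Earlier (swap a b w) b a
    swap-reverses b<′a =
      <-asym b<a (subst₂ (λ p q → toℕ p < toℕ q) (swap-at-b a b w) (swap-at-a a b w) b<′a)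

    -- Anything that preceded b now precedes a (which took b's place).
    swap-keeps-before : ∀ c → Earlier w c b → Earlier (swap a b w) c a
    swap-keeps-before c c<b =
      subst₂ (λ p q → toℕ p < toℕ q) (sym (swap-elsewhere a b w c c≢a c≢b)) (sym (swap-at-a a b w)) c<b
      where
      c≢a : c ≢ a
      c≢a refl = <-asym c<b b<a
      c≢b : c ≢ b
      c≢b refl = <-irrefl refl c<b

    -- Anything not before a stays not before a (a only moved earlier).
    swap-keeps-after : ∀ c → ¬ Earlier w c a → ¬ Earlier (swap a b w) c a
    swap-keeps-after c c≮a with c ≟ a | c ≟ b
    ... | yes refl | _ = <-irrefl refl
    ... | no _     | yes refl = ⊥-elim (c≮a b<a)
    ... | no c≢a   | no c≢b = λ c<′a → c≮a (<-trans (subst₂ (λ p q → toℕ p < toℕ q)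
            (swap-elsewhere a b w c c≢a c≢b) (swap-at-a a b w) c<′a) b<a)

EarlierPrefix : ∀ {n k} → Ordering n → Fin n → Vec (Fin n) k → ℕ → Set
EarlierPrefix w x ys m = ∀ t → Earlier w (lookup ys t) x ⇔ (toℕ t < m)

LadderShape : ∀ {n k} → Ordering n → Fin n → Vec (Fin n) k → ℕ → Set
LadderShape w x ys m = EarlierPrefix w x ys m ×
  (∀ j j′ → toℕ j < toℕ j′ → toℕ j′ < m → Earlier w (lookup ys j) (lookup ys j′))

module _ {n : ℕ} (w : Ordering n) (x : Fin n) where

  entry-≤ : ∀ (b : Bool) j d → (if b then + j else -1ℤ) ℤ.≤ + (j + d)
  entry-≤ true  j d = +≤+ (m≤m+n j d)
  entry-≤ false j d = -≤+

  rungFrom-none : ∀ {k} j (ys : Vec (Fin n) k) → (∀ t → ¬ Earlier w (lookup ys t) x) →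
    rungFrom w x j (toList ys) ≡ -1ℤ
  rungFrom-none j [] _ = refl
  rungFrom-none j (y ∷ ys) none
    rewrite dec-false (earlier? w y x) (none fzero)
          | rungFrom-none (suc j) ys (λ t → none (fsuc t)) = refl

  rungFrom-last : ∀ {k} j (ys : Vec (Fin n) k) (i : Fin k) → Earlier w (lookup ys i) x →
    (∀ t → toℕ i < toℕ t → ¬ Earlier w (lookup ys t) x) →
    rungFrom w x j (toList ys) ≡ + (j + toℕ i)
  rungFrom-last j (y ∷ ys) fzero y<x later
    rewrite dec-true (earlier? w y x) y<x
          | rungFrom-none (suc j) ys (λ t → later (fsuc t) (s≤s z≤n))
          | +-identityʳ j = refl
  rungFrom-last j (y ∷ ys) (fsuc i) yᵢ<x later = begin
      head ⊔ rungFrom w x (suc j) (toList ys) ≡⟨ cong (head ⊔_) (rungFrom-last (suc j) ys i yᵢ<x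
                                                     (λ t i<t → later (fsuc t) (s≤s i<t))) ⟩
      head ⊔ + (suc j + toℕ i)                ≡⟨ cong (λ d → head ⊔ + d) (sym (+-suc j (toℕ i))) ⟩
      head ⊔ + (j + suc (toℕ i))              ≡⟨ i≤j⇒i⊔j≡j (entry-≤ (does (earlier? w y x)) j (suc (toℕ i))) ⟩
      + (j + suc (toℕ i))                     ∎
    where
    open ≡-Reasoning
    head : ℤ
    head = if does (earlier? w y x) then + j else -1ℤ

  rung-of-prefix : ∀ {k} (ys : Vec (Fin n) k) m → EarlierPrefix w x ys m → m ≤ k →
    rung w x ys ≡ + m - + 1
  rung-of-prefix ys zero prefix _ = rungFrom-none 0 ys (λ t t<x → nothing-below-0 (to (prefix t) t<x))
    where
    nothing-below-0 : ∀ {d} → ¬ (d < 0)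
    nothing-below-0 ()
  rung-of-prefix ys (suc m) prefix m<k =
    trans (rungFrom-last 0 ys last last<x after-last) (cong +_ (toℕ-fromℕ< m<k))
    where
    last : Fin _
    last = fromℕ< m<k
    last<x : Earlier w (lookup ys last) x
    last<x = from (prefix last) (subst (_< suc m) (sym (toℕ-fromℕ< m<k)) (n<1+n m))
    after-last : ∀ t → toℕ last < toℕ t → ¬ Earlier w (lookup ys t) x
    after-last t last<t t<x =
      <⇒≱ (subst (_< toℕ t) (toℕ-fromℕ< m<k) last<t) (s≤s⁻¹ (to (prefix t) t<x))

-- Entries before y_i now precede x (x took y_i's place), y_i itself moved
-- behind x, and entries after y_i still follow x.
swap-shortens-prefix : ∀ {n k} (w : Ordering n) (x : Fin n) (ys : Vec (Fin n) k) (i : Fin k) →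
  LadderShape w x ys (suc (toℕ i)) → EarlierPrefix (swap x (lookup ys i) w) x ys (toℕ i)
swap-shortens-prefix w x ys i (prefix , ordered) t = by-position t (<-cmp t i)
  where
  yᵢ : Fin _
  yᵢ = lookup ys i
  yᵢ<x : Earlier w yᵢ x
  yᵢ<x = from (prefix i) (n<1+n _)

  by-position : ∀ t → Tri (t Fin.< i) (t ≡ i) (i Fin.< t) →
    Earlier (swap x yᵢ w) (lookup ys t) x ⇔ (toℕ t < toℕ i)
  by-position t (tri< t<i _ _) =
    mk⇔ (λ _ → t<i) (λ _ → swap-keeps-before w x yᵢ yᵢ<x (lookup ys t) (ordered t i t<i (n<1+n _)))
  by-position t (tri≈ _ refl _) =
    mk⇔ (λ yᵢ<′x → ⊥-elim (swap-reverses w x yᵢ yᵢ<x yᵢ<′x)) (λ i<i → ⊥-elim (<-irrefl refl i<i))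
  by-position t (tri> _ _ i<t) =
    mk⇔ (λ yₜ<′x → ⊥-elim (swap-keeps-after w x yᵢ yᵢ<x (lookup ys t) yₜ≮x yₜ<′x))
        (λ t<i → ⊥-elim (<-asym t<i i<t))
    where
    yₜ≮x : ¬ Earlier w (lookup ys t) x
    yₜ≮x yₜ<x = <⇒≱ i<t (s≤s⁻¹ (to (prefix t) yₜ<x))

rung-index : ∀ m i → + m - + 1 ≡ + i → m ≡ suc i
rung-index zero i ()
rung-index (suc m) i eq = cong suc (+-injective eq)

module Ladder {n k : ℕ} (Ω : OrderingSet n) (x : Fin n) (Y : Vec (Fin n) (suc k))
              (ladder : IsLadder Ω x Y) where
  open IsLadder ladder

  shape-of-rung : ∀ {w} → w ∈ elems Ω → ∀ i → rung w x Y ≡ + i → LadderShape w x Y (suc i)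
  shape-of-rung {w} w∈Ω i rung≡i with cond1 w∈Ω
  ... | m , m≤k , shape = subst (LadderShape w x Y) m≡1+i shape
    where
    m≡1+i : m ≡ suc i
    m≡1+i = rung-index m i (trans (sym (rung-of-prefix w x Y m (proj₁ shape) m≤k)) rung≡i)

  swap-lowers-rung : ∀ (i : Fin (suc k)) {w} → w ∈ W Ω x Y (+ toℕ i) →
    swap x (lookup Y i) w ∈ W Ω x Y (+ toℕ i - + 1)
  swap-lowers-rung i {w} w∈Wᵢ with ∈-filter⁻ (λ v → rung v x Y ℤ.≟ + toℕ i) w∈Wᵢ
  ... | w∈Ω , rung≡i = ∈-filter⁺ (λ v → rung v x Y ℤ.≟ (+ toℕ i - + 1)) swapped∈Ω swapped-rung
    where
    shape : LadderShape w x Y (suc (toℕ i))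
    shape = shape-of-rung w∈Ω (toℕ i) rung≡i
    prefix : EarlierPrefix w x Y (suc (toℕ i))
    prefix = proj₁ shape
    swapped∈Ω : swap x (lookup Y i) w ∈ elems Ω
    swapped∈Ω = cond2 w∈Ω i (from (prefix i) (n<1+n _))
                  (λ j i<j yⱼ<x → <⇒≱ i<j (s≤s⁻¹ (to (prefix j) yⱼ<x)))
    swapped-rung : rung (swap x (lookup Y i) w) x Y ≡ + toℕ i - + 1
    swapped-rung = rung-of-prefix _ x Y (toℕ i) (swap-shortens-prefix w x Y i shape) (<⇒≤ (toℕ<n i))

  ladder-bound : ∀ (i : Fin (suc k)) → length (W Ω x Y (+ toℕ i)) ≤ length (W Ω x Y (+ toℕ i - + 1))
  ladder-bound i =
    injection-length-≤ (swap x (lookup Y i))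
      (Unique.filter⁺ (λ v → rung v x Y ℤ.≟ + toℕ i) (distinct Ω))
      (swap-injective x (lookup Y i)) (swap-lowers-rung i)

lemma2 : ∀ {n k : ℕ} (Ω : OrderingSet n) (x : Fin n) (Y : Vec (Fin n) (suc k)) →
    IsLadder Ω x Y →
    ∀ (i : ℕ) → i < suc k →
    length (W Ω x Y (+ i)) ≤ length (W Ω x Y (+ i - + 1))
lemma2 Ω x Y ladder i i<1+k =
  subst (λ j → length (W Ω x Y (+ j)) ≤ length (W Ω x Y (+ j - + 1)))
        (toℕ-fromℕ< i<1+k) (Ladder.ladder-bound Ω x Y ladder (fromℕ< i<1+k))
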